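{- Let $s\ge 2$, $p\ge 2$ be integers and let $G_{min}(s,p)$ be the graph in $\mathcal{G}(s,p)$ with the minimum number of edges. Then the Laplacian spectrum of $G_{min}(s,p)$ is $$\Big[\tfrac{3s+p+\sqrt{(s+p)^2+4sp}}{2};\ (2s+p)^{2(s-1)};\ (s+p);\ s^{2(p-1)};\ \tfrac{3s+p-\sqrt{(s+p)^2+4sp}}{2};\ 0\Big],$$ where $x^{m}$ denotes the eigenvalue $x$ with multiplicity $m$ (eigenvalues without exponent have multiplicity $1$).
   Context: All graphs are finite, simple and connected. The Laplacian matrix of $G$ is $L(G)=\mathcal{D}(G)-A(G)$ (degree matrix minus adjacency matrix); the Laplacian spectrum is the multiset of its eigenvalues. A vertex is simplicial if its neighbourhood is a clique. A minimal vertex separator is a set $S$ that, for some non-adjacent vertices $u,v$, separates $u$ and $v$ into different components of $G-S$ and is inclusion-minimal with this property. A graph is strictly chordal if it is obtained from a block graph (connected graph all of whose blocks are cliques) by adding zero or more true twins ($N[u]=N[v]$) to each vertex; a strictly interval graph is one that is both strictly chordal and an interval graph. For integers $s,p\ge 2$, $\mathcal{G}(s,p)$ is the set of $SI$-core graphs: strictly interval graphs $G$ with exactly two minimal vertex separators $S_1,S_2$, $|S_1|=|S_2|=s$, $S_1\cup S_2$ a maximal clique of $G$, and each $S_i$ having exactly $p$ simplicial vertices adjacent to it. Explicitly, $V(G)=S_1\cup S_2\cup P_1\cup P_2$ (disjoint), $|P_i|=p$, every vertex of $P_i$ is adjacent to all of $S_i$ and to no vertex of $S_{3-i}\cup P_{3-i}$,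 and $G[P_i]$ is a disjoint union of complete graphs. Thus $G_{min}(s,p)$ is the member in which $P_1$ and $P_2$ are independent sets. -}

module Defs where

open import Data.Bool using (Bool; true; false; if_then_else_; _∧_; _∨_; not)
open import Data.Nat as ℕ using (ℕ; zero; suc; _<ᵇ_; _≡ᵇ_)
open import Data.Fin using (Fin; zero; suc; toℕ; punchIn)
open import Data.Integer using (ℤ; +_; _+_; _-_; _*_; -_)

Graph : ℕ → Set
Graph n = Fin n → Fin n → Bool

Matrix : ℕ → Set
Matrix n = Fin n → Fin n → ℤ

sumFin : (n : ℕ) → (Fin n → ℤ) → ℤ
sumFin zero    f = + 0
sumFin (suc n) f = f zero + sumFin n (λ i → f (suc i))

boolToℤ : Bool → ℤ
boolToℤ true  = + 1
boolToℤ false = + 0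

degree : {n : ℕ} → Graph n → Fin n → ℤ
degree {n} A i = sumFin n (λ j → boolToℤ (A i j))

laplacian : {n : ℕ} → Graph n → Matrix n
laplacian A i j = if toℕ i ≡ᵇ toℕ j then degree A i else - boolToℤ (A i j)

sign : ℕ → ℤ
sign zero          = + 1
sign (suc zero)    = - (+ 1)
sign (suc (suc k)) = sign k

det : (n : ℕ) → Matrix n → ℤ
det zero    M = + 1
det (suc n) M =
  sumFin (suc n) (λ j → sign (toℕ j) * M zero j * det n (λ a b → M (suc a) (punchIn j b)))

charPolyAt : {n : ℕ} → Matrix n → ℤ → ℤ
charPolyAt {n} M t = det n (λ i j → (if toℕ i ≡ᵇ toℕ j then t else + 0) - M i j)

-- G_min(s,p): vertex set Fin (s + s + p + p) laid out as
--   S₁ = [0, s), S₂ = [s, 2s), P₁ = [2s, 2s+p), P₂ = [2s+p, 2s+2p).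
-- S₁ ∪ S₂ is a clique; each vertex of Pᵢ is adjacent to exactly the vertices of Sᵢ;
-- P₁ and P₂ are independent sets.
data Part : Set where
  S₁ S₂ P₁ P₂ : Part

part : (s p : ℕ) → ℕ → Part
part s p k =
  if k <ᵇ s then S₁ else
  (if k <ᵇ (s ℕ.+ s) then S₂ else
  (if k <ᵇ (s ℕ.+ s ℕ.+ p) then P₁ else P₂))

adjPart : Part → Part → Bool
adjPart S₁ S₁ = true
adjPart S₁ S₂ = true
adjPart S₂ S₁ = true
adjPart S₂ S₂ = true
adjPart S₁ P₁ = true
adjPart P₁ S₁ = true
adjPart S₂ P₂ = true
adjPart P₂ S₂ = true
adjPart _  _  = false

Gmin : (s p : ℕ) → Graph (s ℕ.+ s ℕ.+ p ℕ.+ p)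
Gmin s p i j = not (toℕ i ≡ᵇ toℕ j) ∧ adjPart (part s p (toℕ i)) (part s p (toℕ j))

-- Write t·I − L(G_min) as the matrix with t − deg v on the diagonal and the adjacency of G_min off
-- it.  Two vertices of the same part are twins: their rows differ by γ (eᵤ − eᵥ), where the gap γ of
-- the part is its diagonal entry minus the entry between two of its vertices, and their columns agree
-- elsewhere.  Subtracting one twin row from the other and expanding gives the recurrence
-- D(k+2) = γ (2 D(k+1) − γ D(k)) in the size k of a part, solved by D(k+1) = γᵏ ((k+1) D(1) − k γ D(0)).
-- Unrolling the four parts leaves sixteen determinants of order at most four, which are evaluated
-- symbolically; one ring identity, with γ = t − (2s + p) on S₁ ∪ S₂ and γ = t − s on P₁ ∪ P₂, then
-- gives the factorisation.

module Submission where

open import Defs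
open import Data.Nat using (ℕ; _≤_; _∸_)
open import Data.Integer using (ℤ; +_; _+_; _-_; _*_; _^_)
open import Relation.Binary.PropositionalEquality using (_≡_)

open import Data.Bool using (Bool; true; false; if_then_else_; _∧_; not)
open import Data.Bool.Properties using (T-≡)
open import Data.Empty using (⊥-elim)
open import Data.Fin using (Fin; zero; suc; toℕ; punchIn; punchOut; inject₁; fromℕ<)
import Data.Fin as Fin
open import Data.Fin.Properties
  using (punchInᵢ≢i; punchIn-injective; punchOut-cong; punchOut-punchIn; suc-injective; toℕ-inject₁; toℕ-fromℕ<)
open import Data.Integer using (-[1+_]; -_)
import Data.Integer.Properties as ℤ
open import Data.Integer.Tactic.RingSolver using (solve-∀; ring)
open import Data.List using (List; []; _∷_; _++_; _∷ʳ_; length; replicate; map)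
open import Data.List.Properties
  using (length-++-≤ˡ; length-++-sucʳ; ++-identityʳ; ∷ʳ-++)
open import Data.Nat as ℕ using (zero; suc; _≡ᵇ_; _<ᵇ_; _<_; s≤s)
open import Data.Nat.Properties using (1+n≢n; ≡ᵇ⇒≡; +-identityʳ; +-suc)
open import Data.Product using (_×_; _,_)
open import Data.Vec using (Vec; []; _∷_)
open import Function using (_∘_)
open import Function.Bundles using (Equivalence)
open import Relation.Nullary using (yes; no)
open import Relation.Binary.PropositionalEquality
open import Tactic.RingSolver.NonReflective ring using (Expr; Κ; Ι; _⊕_; _⊗_; ⊝_; module Ops)
open Ops using (⟦_⟧; prove)

private
  variable
    n : ℕ

-- Finite sums and signs

sumFin-cong : ∀ n {f g : Fin n → ℤ} → (∀ i → f i ≡ g i) → sumFin n f ≡ sumFin n g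
sumFin-cong zero    f≗g = refl
sumFin-cong (suc n) f≗g = cong₂ _+_ (f≗g zero) (sumFin-cong n (f≗g ∘ suc))

sumFin-zero : ∀ n → sumFin n (λ _ → + 0) ≡ + 0
sumFin-zero zero    = refl
sumFin-zero (suc n) = trans (ℤ.+-identityˡ _) (sumFin-zero n)

sumFin-distrib-+ : ∀ n (f g : Fin n → ℤ) →
  sumFin n (λ i → f i + g i) ≡ sumFin n f + sumFin n g
sumFin-distrib-+ zero    f g = refl
sumFin-distrib-+ (suc n) f g =
  trans (cong (_+_ (f zero + g zero)) (sumFin-distrib-+ n (f ∘ suc) (g ∘ suc)))
        (exchange (f zero) (g zero) _ _)
  where
  exchange : ∀ a b c d → a + b + (c + d) ≡ a + c + (b + d)
  exchange = solve-∀

sumFin-*ˡ : ∀ n c (f : Fin n → ℤ) → sumFin n (λ i → c * f i) ≡ c * sumFin n f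
sumFin-*ˡ zero    c f = sym (ℤ.*-zeroʳ c)
sumFin-*ˡ (suc n) c f =
  trans (cong (_+_ (c * f zero)) (sumFin-*ˡ n c (f ∘ suc))) (sym (ℤ.*-distribˡ-+ c _ _))

sumFin-neg : ∀ n (f : Fin n → ℤ) → sumFin n (λ i → - f i) ≡ - sumFin n f
sumFin-neg zero    f = refl
sumFin-neg (suc n) f =
  trans (cong (_+_ (- f zero)) (sumFin-neg n (f ∘ suc))) (sym (ℤ.neg-distrib-+ (f zero) _))

sumFin-punchIn : ∀ n (k : Fin (suc n)) f →
  sumFin (suc n) f ≡ f k + sumFin n (f ∘ punchIn k)
sumFin-punchIn n       zero    f = refl
sumFin-punchIn (suc n) (suc k) f =
  trans (cong (_+_ (f zero)) (sumFin-punchIn n k (f ∘ suc)))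
        (swap (f zero) (f (suc k)) _)
  where
  swap : ∀ a b c → a + (b + c) ≡ b + (a + c)
  swap = solve-∀

sumFin-comm : ∀ n m (f : Fin n → Fin m → ℤ) →
  sumFin n (λ i → sumFin m (f i)) ≡ sumFin m (λ j → sumFin n (λ i → f i j))
sumFin-comm zero    m f = sym (sumFin-zero m)
sumFin-comm (suc n) m f =
  trans (cong (_+_ (sumFin m (f zero))) (sumFin-comm n m (f ∘ suc)))
        (sym (sumFin-distrib-+ m (f zero) (λ j → sumFin n (λ i → f (suc i) j))))

≡ᵇ-refl : (i : Fin n) → (toℕ i ≡ᵇ toℕ i) ≡ true
≡ᵇ-refl zero    = refl
≡ᵇ-refl (suc i) = ≡ᵇ-refl i

≢⇒≡ᵇ-false : {i j : Fin n} → i ≢ j → (toℕ i ≡ᵇ toℕ j) ≡ false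
≢⇒≡ᵇ-false {i = zero}  {zero}  i≢j = ⊥-elim (i≢j refl)
≢⇒≡ᵇ-false {i = zero}  {suc j} i≢j = refl
≢⇒≡ᵇ-false {i = suc i} {zero}  i≢j = refl
≢⇒≡ᵇ-false {i = suc i} {suc j} i≢j = ≢⇒≡ᵇ-false (i≢j ∘ cong suc)

δ : Fin n → Fin n → ℤ
δ i j = boolToℤ (toℕ i ≡ᵇ toℕ j)

sumFin-δ : ∀ n (k : Fin n) (f : Fin n → ℤ) → sumFin n (λ j → δ k j * f j) ≡ f k
sumFin-δ (suc n) k f = begin
  sumFin (suc n) (λ j → δ k j * f j)
    ≡⟨ sumFin-punchIn n k (λ j → δ k j * f j) ⟩
  δ k k * f k + sumFin n (λ i → δ k (punchIn k i) * f (punchIn k i))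
    ≡⟨ cong₂ _+_ (cong (λ b → boolToℤ b * f k) (≡ᵇ-refl k))
                 (sumFin-cong n (λ i → cong (λ b → boolToℤ b * f (punchIn k i))
                                            (≢⇒≡ᵇ-false (punchInᵢ≢i k i ∘ sym)))) ⟩
  + 1 * f k + sumFin n (λ i → + 0)
    ≡⟨ cong₂ _+_ (ℤ.*-identityˡ (f k)) (sumFin-zero n) ⟩
  f k + + 0
    ≡⟨ ℤ.+-identityʳ (f k) ⟩
  f k ∎
  where open ≡-Reasoning

sign-suc : ∀ k → sign (suc k) ≡ - sign k
sign-suc zero          = refl
sign-suc (suc zero)    = refl
sign-suc (suc (suc k)) = sign-suc k

sign-*-sign : ∀ k → sign k * sign k ≡ + 1
sign-*-sign zero          = refl
sign-*-sign (suc zero)    = refl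
sign-*-sign (suc (suc k)) = sign-*-sign k

sign-cancelˡ : ∀ k x → sign k * (sign k * x) ≡ x
sign-cancelˡ k x = begin
  sign k * (sign k * x) ≡⟨ ℤ.*-assoc (sign k) (sign k) x ⟨
  sign k * sign k * x   ≡⟨ cong (_* x) (sign-*-sign k) ⟩
  + 1 * x               ≡⟨ ℤ.*-identityˡ x ⟩
  x                     ∎
  where open ≡-Reasoning

sign-suc-*-sign-suc : ∀ a b → sign (suc a) * sign (suc b) ≡ sign a * sign b
sign-suc-*-sign-suc a b = begin
  sign (suc a) * sign (suc b) ≡⟨ cong₂ _*_ (sign-suc a) (sign-suc b) ⟩
  - sign a * - sign b         ≡⟨ neg-*-neg (sign a) (sign b) ⟩
  sign a * sign b             ∎
  where
  open ≡-Reasoning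
  neg-*-neg : ∀ x y → - x * - y ≡ x * y
  neg-*-neg = solve-∀

-- Determinants

det-cong : ∀ n {M N : Matrix n} → (∀ i j → M i j ≡ N i j) → det n M ≡ det n N
det-cong zero    M≗N = refl
det-cong (suc n) M≗N = sumFin-cong (suc n) (λ j →
  cong₂ (λ a b → sign (toℕ j) * a * b) (M≗N zero j)
        (det-cong n (λ a b → M≗N (suc a) (punchIn j b))))

punchIn-punchOut-comm : ∀ n (k m : Fin (suc (suc n))) (k≢m : k ≢ m) (m≢k : m ≢ k) (b : Fin n) →
  punchIn k (punchIn (punchOut k≢m) b) ≡ punchIn m (punchIn (punchOut m≢k) b)
punchIn-punchOut-comm n       zero    zero    k≢m m≢k b       = ⊥-elim (k≢m refl)
punchIn-punchOut-comm n       zero    (suc m) k≢m m≢k b       = refl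
punchIn-punchOut-comm n       (suc k) zero    k≢m m≢k b       = refl
punchIn-punchOut-comm zero    (suc zero) (suc zero) k≢m m≢k b = ⊥-elim (k≢m refl)
punchIn-punchOut-comm (suc n) (suc k) (suc m) k≢m m≢k zero    = refl
punchIn-punchOut-comm (suc n) (suc k) (suc m) k≢m m≢k (suc b) =
  cong suc (punchIn-punchOut-comm n k m (k≢m ∘ cong suc) (m≢k ∘ cong suc) b)

sign-punchOut-antisym : ∀ n (k m : Fin (suc (suc n))) (k≢m : k ≢ m) (m≢k : m ≢ k) →
  sign (toℕ k) * sign (toℕ (punchOut k≢m)) ≡ - (sign (toℕ m) * sign (toℕ (punchOut m≢k)))
sign-punchOut-antisym n zero zero k≢m m≢k = ⊥-elim (k≢m refl)
sign-punchOut-antisym n zero (suc m) k≢m m≢k = begin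
  + 1 * sign (toℕ m)         ≡⟨ flip (sign (toℕ m)) ⟩
  - (- sign (toℕ m) * + 1)   ≡⟨ cong (λ z → - (z * + 1)) (sign-suc (toℕ m)) ⟨
  - (sign (suc (toℕ m)) * + 1) ∎
  where
  open ≡-Reasoning
  flip : ∀ x → + 1 * x ≡ - (- x * + 1)
  flip = solve-∀
sign-punchOut-antisym n (suc k) zero k≢m m≢k = begin
  sign (suc (toℕ k)) * + 1 ≡⟨ cong (_* + 1) (sign-suc (toℕ k)) ⟩
  - sign (toℕ k) * + 1     ≡⟨ flip (sign (toℕ k)) ⟩
  - (+ 1 * sign (toℕ k))   ∎
  where
  open ≡-Reasoning
  flip : ∀ x → - x * + 1 ≡ - (+ 1 * x)
  flip = solve-∀
sign-punchOut-antisym zero (suc zero) (suc zero) k≢m m≢k = ⊥-elim (k≢m refl)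
sign-punchOut-antisym (suc n) (suc k) (suc m) k≢m m≢k =
  let k≢m′ = k≢m ∘ cong suc; m≢k′ = m≢k ∘ cong suc in begin
  sign (suc (toℕ k)) * sign (suc (toℕ (punchOut k≢m′)))
    ≡⟨ sign-suc-*-sign-suc (toℕ k) (toℕ (punchOut k≢m′)) ⟩
  sign (toℕ k) * sign (toℕ (punchOut k≢m′))
    ≡⟨ sign-punchOut-antisym n k m k≢m′ m≢k′ ⟩
  - (sign (toℕ m) * sign (toℕ (punchOut m≢k′)))
    ≡⟨ cong -_ (sign-suc-*-sign-suc (toℕ m) (toℕ (punchOut m≢k′))) ⟨
  - (sign (suc (toℕ m)) * sign (suc (toℕ (punchOut m≢k′)))) ∎
  where open ≡-Reasoning

-- Expanding along the first two rows, det M = Σₖ Σₘ M₀ₖ M₁ₘ cofactor₂ k m with an antisymmetric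
-- kernel; this is why exchanging the first two rows negates the determinant.
cofactor₂ : ∀ n → (Fin n → Fin (suc (suc n)) → ℤ) → Fin (suc (suc n)) → Fin (suc (suc n)) → ℤ
cofactor₂ n R k m with k Fin.≟ m
... | yes _   = + 0
... | no  k≢m = sign (toℕ k) * sign (toℕ (punchOut k≢m))
              * det n (λ a b → R a (punchIn k (punchIn (punchOut k≢m) b)))

cofactor₂-diag : ∀ n R k → cofactor₂ n R k k ≡ + 0
cofactor₂-diag n R k with k Fin.≟ k
... | yes _   = refl
... | no  k≢k = ⊥-elim (k≢k refl)

cofactor₂-punchIn : ∀ n R k l → cofactor₂ n R k (punchIn k l)
  ≡ sign (toℕ k) * sign (toℕ l) * det n (λ a b → R a (punchIn k (punchIn l b)))
cofactor₂-punchIn n R k l with k Fin.≟ punchIn k l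
... | yes k≡k[l] = ⊥-elim (punchInᵢ≢i k l (sym k≡k[l]))
... | no  k≢k[l] = cong (λ l′ → sign (toℕ k) * sign (toℕ l′) * det n (λ a b → R a (punchIn k (punchIn l′ b))))
  (trans (punchOut-cong k {i≢j = k≢k[l]} {i≢k = punchInᵢ≢i k l ∘ sym} refl) (punchOut-punchIn k))

cofactor₂-antisym : ∀ n R k m → cofactor₂ n R k m ≡ - cofactor₂ n R m k
cofactor₂-antisym n R k m with k Fin.≟ m | m Fin.≟ k
... | yes _   | yes _   = refl
... | yes k≡m | no  m≢k = ⊥-elim (m≢k (sym k≡m))
... | no  k≢m | yes m≡k = ⊥-elim (k≢m (sym m≡k))
... | no  k≢m | no  m≢k = begin
  sign (toℕ k) * sign (toℕ (punchOut k≢m)) * det n (λ a b → R a (punchIn k (punchIn (punchOut k≢m) b)))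
    ≡⟨ cong₂ _*_ (sign-punchOut-antisym n k m k≢m m≢k)
                 (det-cong n (λ a b → cong (R a) (punchIn-punchOut-comm n k m k≢m m≢k b))) ⟩
  - (sign (toℕ m) * sign (toℕ (punchOut m≢k))) * D
    ≡⟨ ℤ.neg-distribˡ-* (sign (toℕ m) * sign (toℕ (punchOut m≢k))) D ⟨
  - (sign (toℕ m) * sign (toℕ (punchOut m≢k)) * D) ∎
  where
  open ≡-Reasoning
  D = det n (λ a b → R a (punchIn m (punchIn (punchOut m≢k) b)))

det-expand₂ : ∀ n (M : Matrix (suc (suc n))) → det (suc (suc n)) M ≡
  sumFin (suc (suc n)) (λ k → sumFin (suc (suc n)) (λ m →
    M zero k * M (suc zero) m * cofactor₂ n (λ a → M (suc (suc a))) k m))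
det-expand₂ n M = sumFin-cong (suc (suc n)) expandRow₁
  where
  R = λ a → M (suc (suc a))
  C = cofactor₂ n R
  expandRow₁ : ∀ k → sign (toℕ k) * M zero k * det (suc n) (λ a b → M (suc a) (punchIn k b))
                   ≡ sumFin (suc (suc n)) (λ m → M zero k * M (suc zero) m * C k m)
  expandRow₁ k = begin
    s * a * sumFin (suc n) (λ l → sign (toℕ l) * M (suc zero) (punchIn k l) * det n (minor l))
      ≡⟨ sumFin-*ˡ (suc n) (s * a) (λ l → sign (toℕ l) * M (suc zero) (punchIn k l) * det n (minor l)) ⟨
    sumFin (suc n) (λ l → s * a * (sign (toℕ l) * M (suc zero) (punchIn k l) * det n (minor l)))
      ≡⟨ sumFin-cong (suc n) (λ l →
           trans (regroup s a (sign (toℕ l)) (M (suc zero) (punchIn k l)) (det n (minor l)))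
                 (cong (a * M (suc zero) (punchIn k l) *_) (sym (cofactor₂-punchIn n R k l)))) ⟩
    rest
      ≡⟨ ℤ.+-identityˡ rest ⟨
    + 0 + rest
      ≡⟨ cong (_+ rest) (trans (sym (ℤ.*-zeroʳ (a * M (suc zero) k)))
                               (cong (a * M (suc zero) k *_) (sym (cofactor₂-diag n R k)))) ⟩
    a * M (suc zero) k * C k k + rest
      ≡⟨ sumFin-punchIn (suc n) k (λ m → a * M (suc zero) m * C k m) ⟨
    sumFin (suc (suc n)) (λ m → a * M (suc zero) m * C k m) ∎
    where
    open ≡-Reasoning
    s = sign (toℕ k)
    a = M zero k
    minor = λ l a b → R a (punchIn k (punchIn l b))
    rest = sumFin (suc n) (λ l → a * M (suc zero) (punchIn k l) * C k (punchIn k l))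
    regroup : ∀ s a t b D → s * a * (t * b * D) ≡ a * b * (s * t * D)
    regroup = solve-∀

swapAdjacent : Fin (suc n) → Fin (suc (suc n)) → Fin (suc (suc n))
swapAdjacent zero    zero          = suc zero
swapAdjacent zero    (suc zero)    = zero
swapAdjacent zero    (suc (suc a)) = suc (suc a)
swapAdjacent {suc n} (suc r) zero    = zero
swapAdjacent {suc n} (suc r) (suc a) = suc (swapAdjacent r a)

det-swapFirstRows : ∀ n (M : Matrix (suc (suc n))) →
  det (suc (suc n)) (M ∘ swapAdjacent zero) ≡ - det (suc (suc n)) M
det-swapFirstRows n M = begin
  det N (M ∘ swapAdjacent zero)
    ≡⟨ det-expand₂ n (M ∘ swapAdjacent zero) ⟩
  sumFin N (λ k → sumFin N (λ m → M (suc zero) k * M zero m * C k m))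
    ≡⟨ sumFin-comm N N (λ k m → M (suc zero) k * M zero m * C k m) ⟩
  sumFin N (λ m → sumFin N (λ k → M (suc zero) k * M zero m * C k m))
    ≡⟨ sumFin-cong N (λ m → sumFin-cong N (λ k → begin
         M (suc zero) k * M zero m * C k m       ≡⟨ cong (M (suc zero) k * M zero m *_) (cofactor₂-antisym n R k m) ⟩
         M (suc zero) k * M zero m * - C m k     ≡⟨ flip (M zero m) (M (suc zero) k) (C m k) ⟩
         - (M zero m * M (suc zero) k * C m k)   ∎)) ⟩
  sumFin N (λ m → sumFin N (λ k → - (M zero m * M (suc zero) k * C m k)))
    ≡⟨ sumFin-cong N (λ m → sumFin-neg N (λ k → M zero m * M (suc zero) k * C m k)) ⟩
  sumFin N (λ m → - sumFin N (λ k → M zero m * M (suc zero) k * C m k))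
    ≡⟨ sumFin-neg N (λ m → sumFin N (λ k → M zero m * M (suc zero) k * C m k)) ⟩
  - sumFin N (λ m → sumFin N (λ k → M zero m * M (suc zero) k * C m k))
    ≡⟨ cong -_ (det-expand₂ n M) ⟨
  - det N M ∎
  where
  open ≡-Reasoning
  N = suc (suc n)
  R = λ a → M (suc (suc a))
  C = cofactor₂ n R
  flip : ∀ a b c → b * a * - c ≡ - (a * b * c)
  flip = solve-∀

det-swapAdjacent : ∀ n (r : Fin (suc n)) (M : Matrix (suc (suc n))) →
  det (suc (suc n)) (M ∘ swapAdjacent r) ≡ - det (suc (suc n)) M
det-swapAdjacent n       zero    M = det-swapFirstRows n M
det-swapAdjacent (suc n) (suc r) M = begin
  sumFin N (λ j → sign (toℕ j) * M zero j * det (suc (suc n)) (minor j ∘ swapAdjacent r))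
    ≡⟨ sumFin-cong N (λ j → cong (sign (toℕ j) * M zero j *_) (det-swapAdjacent n r (minor j))) ⟩
  sumFin N (λ j → sign (toℕ j) * M zero j * - det (suc (suc n)) (minor j))
    ≡⟨ sumFin-cong N (λ j → ℤ.neg-distribʳ-* (sign (toℕ j) * M zero j) (det (suc (suc n)) (minor j))) ⟨
  sumFin N (λ j → - (sign (toℕ j) * M zero j * det (suc (suc n)) (minor j)))
    ≡⟨ sumFin-neg N (λ j → sign (toℕ j) * M zero j * det (suc (suc n)) (minor j)) ⟩
  - det N M ∎
  where
  open ≡-Reasoning
  N = suc (suc (suc n))
  minor = λ j a b → M (suc a) (punchIn j b)

swapAdjacent-equalRows : ∀ {n m} (r : Fin (suc n)) (M : Fin (suc (suc n)) → Fin m → ℤ) →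
  (∀ j → M (inject₁ r) j ≡ M (suc r) j) → ∀ i j → M (swapAdjacent r i) j ≡ M i j
swapAdjacent-equalRows zero M eq zero          j = sym (eq j)
swapAdjacent-equalRows zero M eq (suc zero)    j = eq j
swapAdjacent-equalRows zero M eq (suc (suc i)) j = refl
swapAdjacent-equalRows {suc n} (suc r) M eq zero    j = refl
swapAdjacent-equalRows {suc n} (suc r) M eq (suc i) j = swapAdjacent-equalRows r (M ∘ suc) eq i j

x≡-x⇒x≡0 : ∀ x → x ≡ - x → x ≡ + 0
x≡-x⇒x≡0 (+ zero)    _ = refl
x≡-x⇒x≡0 (+ (suc n)) ()
x≡-x⇒x≡0 -[1+ n ]    ()

det-equalAdjacentRows : ∀ n (r : Fin (suc n)) (M : Matrix (suc (suc n))) →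
  (∀ j → M (inject₁ r) j ≡ M (suc r) j) → det (suc (suc n)) M ≡ + 0
det-equalAdjacentRows n r M eq = x≡-x⇒x≡0 (det (suc (suc n)) M)
  (trans (det-cong (suc (suc n)) (λ i j → sym (swapAdjacent-equalRows r M eq i j)))
         (det-swapAdjacent n r M))

moveToTop : Fin (suc n) → Fin (suc n) → Fin (suc n)
moveToTop r zero    = r
moveToTop r (suc k) = punchIn r k

det-moveToTop : ∀ n (r : Fin (suc n)) (M : Matrix (suc n)) →
  det (suc n) (M ∘ moveToTop r) ≡ sign (toℕ r) * det (suc n) M
det-moveToTop n zero M =
  trans (det-cong (suc n) topFixed) (sym (ℤ.*-identityˡ (det (suc n) M)))
  where
  topFixed : ∀ i j → M (moveToTop zero i) j ≡ M i j
  topFixed zero    j = refl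
  topFixed (suc i) j = refl
det-moveToTop (suc n) (suc r) M = begin
  det N (M ∘ moveToTop (suc r))
    ≡⟨ det-cong N split ⟩
  det N (K ∘ swapAdjacent zero)
    ≡⟨ det-swapFirstRows n K ⟩
  - det N K
    ≡⟨ cong -_ detK ⟩
  - (sign (toℕ r) * det N M)
    ≡⟨ ℤ.neg-distribˡ-* (sign (toℕ r)) (det N M) ⟩
  - sign (toℕ r) * det N M
    ≡⟨ cong (_* det N M) (sign-suc (toℕ r)) ⟨
  sign (suc (toℕ r)) * det N M ∎
  where
  open ≡-Reasoning
  N = suc (suc n)
  K : Matrix N
  K zero    = M zero
  K (suc a) = M (suc (moveToTop r a))
  split : ∀ i j → M (moveToTop (suc r) i) j ≡ K (swapAdjacent zero i) j
  split zero          j = refl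
  split (suc zero)    j = refl
  split (suc (suc i)) j = refl
  minor = λ j a b → M (suc a) (punchIn j b)
  detK : det N K ≡ sign (toℕ r) * det N M
  detK = begin
    sumFin N (λ j → sign (toℕ j) * M zero j * det (suc n) (minor j ∘ moveToTop r))
      ≡⟨ sumFin-cong N (λ j → cong (sign (toℕ j) * M zero j *_) (det-moveToTop n r (minor j))) ⟩
    sumFin N (λ j → sign (toℕ j) * M zero j * (sign (toℕ r) * det (suc n) (minor j)))
      ≡⟨ sumFin-cong N (λ j → pull (sign (toℕ j)) (M zero j) (sign (toℕ r)) (det (suc n) (minor j))) ⟩
    sumFin N (λ j → sign (toℕ r) * (sign (toℕ j) * M zero j * det (suc n) (minor j)))
      ≡⟨ sumFin-*ˡ N (sign (toℕ r)) (λ j → sign (toℕ j) * M zero j * det (suc n) (minor j)) ⟩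
    sign (toℕ r) * det N M ∎
    where
    pull : ∀ a b s D → a * b * (s * D) ≡ s * (a * b * D)
    pull = solve-∀

det-expandRow : ∀ n (r : Fin (suc n)) (M : Matrix (suc n)) → det (suc n) M ≡
  sign (toℕ r) * sumFin (suc n) (λ j → sign (toℕ j) * M r j * det n (λ a b → M (punchIn r a) (punchIn j b)))
det-expandRow n r M = begin
  det (suc n) M                                  ≡⟨ sign-cancelˡ (toℕ r) (det (suc n) M) ⟨
  sign (toℕ r) * (sign (toℕ r) * det (suc n) M)  ≡⟨ cong (sign (toℕ r) *_) (det-moveToTop n r M) ⟨
  sign (toℕ r) * det (suc n) (M ∘ moveToTop r)   ∎
  where open ≡-Reasoning

det-linearRow : ∀ n (r : Fin n) (A B C : Matrix n) (c : ℤ) →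
  (∀ i → i ≢ r → ∀ j → C i j ≡ A i j) → (∀ i → i ≢ r → ∀ j → B i j ≡ A i j) →
  (∀ j → C r j ≡ A r j + c * B r j) → det n C ≡ det n A + c * det n B
det-linearRow (suc n) zero A B C c C≗A B≗A Cᵣ = begin
  det (suc n) C
    ≡⟨ sumFin-cong (suc n) (λ j → cong₂ (λ x y → sign (toℕ j) * x * y) (Cᵣ j)
          (det-cong n (λ a b → C≗A (suc a) (λ ()) (punchIn j b)))) ⟩
  sumFin (suc n) (λ j → sign (toℕ j) * (A zero j + c * B zero j) * det n (minor A j))
    ≡⟨ sumFin-cong (suc n) (λ j → expand (sign (toℕ j)) (A zero j) c (B zero j) (det n (minor A j))) ⟩
  sumFin (suc n) (λ j → term A j + c * (sign (toℕ j) * B zero j * det n (minor A j)))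
    ≡⟨ sumFin-distrib-+ (suc n) (term A) (λ j → c * (sign (toℕ j) * B zero j * det n (minor A j))) ⟩
  det (suc n) A + sumFin (suc n) (λ j → c * (sign (toℕ j) * B zero j * det n (minor A j)))
    ≡⟨ cong (_+_ (det (suc n) A)) (sumFin-*ˡ (suc n) c (λ j → sign (toℕ j) * B zero j * det n (minor A j))) ⟩
  det (suc n) A + c * sumFin (suc n) (λ j → sign (toℕ j) * B zero j * det n (minor A j))
    ≡⟨ cong (λ z → det (suc n) A + c * z) (sumFin-cong (suc n) (λ j → cong (sign (toℕ j) * B zero j *_)
          (det-cong n (λ a b → sym (B≗A (suc a) (λ ()) (punchIn j b)))))) ⟩
  det (suc n) A + c * det (suc n) B ∎
  where
  open ≡-Reasoning
  minor = λ (M : Matrix (suc n)) j a b → M (suc a) (punchIn j b)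
  term = λ (M : Matrix (suc n)) j → sign (toℕ j) * M zero j * det n (minor M j)
  expand : ∀ s a c b D → s * (a + c * b) * D ≡ s * a * D + c * (s * b * D)
  expand = solve-∀
det-linearRow (suc n) (suc r) A B C c C≗A B≗A Cᵣ = begin
  det (suc n) C
    ≡⟨ sumFin-cong (suc n) (λ j → cong₂ (λ x y → sign (toℕ j) * x * y) (C≗A zero (λ ()) j)
          (det-linearRow n r (minor A j) (minor B j) (minor C j) c
             (λ i i≢r k → C≗A (suc i) (i≢r ∘ suc-injective) (punchIn j k))
             (λ i i≢r k → B≗A (suc i) (i≢r ∘ suc-injective) (punchIn j k))
             (λ k → Cᵣ (punchIn j k)))) ⟩
  sumFin (suc n) (λ j → sign (toℕ j) * A zero j * (det n (minor A j) + c * det n (minor B j)))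
    ≡⟨ sumFin-cong (suc n) (λ j → expand (sign (toℕ j)) (A zero j) c (det n (minor A j)) (det n (minor B j))) ⟩
  sumFin (suc n) (λ j → term A j + c * (sign (toℕ j) * A zero j * det n (minor B j)))
    ≡⟨ sumFin-distrib-+ (suc n) (term A) (λ j → c * (sign (toℕ j) * A zero j * det n (minor B j))) ⟩
  det (suc n) A + sumFin (suc n) (λ j → c * (sign (toℕ j) * A zero j * det n (minor B j)))
    ≡⟨ cong (_+_ (det (suc n) A)) (sumFin-*ˡ (suc n) c (λ j → sign (toℕ j) * A zero j * det n (minor B j))) ⟩
  det (suc n) A + c * sumFin (suc n) (λ j → sign (toℕ j) * A zero j * det n (minor B j))
    ≡⟨ cong (λ z → det (suc n) A + c * z) (sumFin-cong (suc n) (λ j →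
          cong (λ x → sign (toℕ j) * x * det n (minor B j)) (sym (B≗A zero (λ ()) j)))) ⟩
  det (suc n) A + c * det (suc n) B ∎
  where
  open ≡-Reasoning
  minor = λ (M : Matrix (suc n)) j a b → M (suc a) (punchIn j b)
  term = λ (M : Matrix (suc n)) j → sign (toℕ j) * M zero j * det n (minor M j)
  expand : ∀ s a c DA DB → s * a * (DA + c * DB) ≡ s * a * DA + c * (s * a * DB)
  expand = solve-∀

-- Twin rows

replaceRow : Fin n → (Fin n → ℤ) → Matrix n → Matrix n
replaceRow r v M i j = if toℕ i ≡ᵇ toℕ r then v j else M i j

replaceRow-≡ : ∀ (r : Fin n) v M j → replaceRow r v M r j ≡ v j
replaceRow-≡ r v M j rewrite ≡ᵇ-refl r = refl

replaceRow-≢ : ∀ (r : Fin n) v M {i} j → i ≢ r → replaceRow r v M i j ≡ M i j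
replaceRow-≢ r v M j i≢r rewrite ≢⇒≡ᵇ-false i≢r = refl

minor : Fin (suc n) → Fin (suc n) → Matrix (suc n) → Matrix n
minor r c M a b = M (punchIn r a) (punchIn c b)

principalMinor : Fin (suc n) → Matrix (suc n) → Matrix n
principalMinor r = minor r r

det-replaceRow-unit : ∀ n (r : Fin (suc n)) (M : Matrix (suc n)) →
  det (suc n) (replaceRow r (δ r) M) ≡ det n (principalMinor r M)
det-replaceRow-unit n r M = begin
  det (suc n) E
    ≡⟨ det-expandRow n r E ⟩
  sign (toℕ r) * sumFin (suc n) (λ j → sign (toℕ j) * E r j * det n (minor r j E))
    ≡⟨ cong (sign (toℕ r) *_) (sumFin-cong (suc n) (λ j →
         trans (cong (λ x → sign (toℕ j) * x * det n (minor r j E)) (replaceRow-≡ r (δ r) M j))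
               (swap (sign (toℕ j)) (δ r j) (det n (minor r j E))))) ⟩
  sign (toℕ r) * sumFin (suc n) (λ j → δ r j * (sign (toℕ j) * det n (minor r j E)))
    ≡⟨ cong (sign (toℕ r) *_) (sumFin-δ (suc n) r (λ j → sign (toℕ j) * det n (minor r j E))) ⟩
  sign (toℕ r) * (sign (toℕ r) * det n (minor r r E))
    ≡⟨ sign-cancelˡ (toℕ r) (det n (minor r r E)) ⟩
  det n (minor r r E)
    ≡⟨ det-cong n (λ a b → replaceRow-≢ r (δ r) M (punchIn r b) (punchInᵢ≢i r a)) ⟩
  det n (principalMinor r M) ∎
  where
  open ≡-Reasoning
  E = replaceRow r (δ r) M
  swap : ∀ s d D → s * d * D ≡ d * (s * D)
  swap = solve-∀

det-perturbDiagonal : ∀ n (r : Fin (suc n)) (M N : Matrix (suc n)) (c : ℤ) →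
  (∀ i → i ≢ r → ∀ j → N i j ≡ M i j) → (∀ j → N r j ≡ M r j + c * δ r j) →
  det (suc n) N ≡ det (suc n) M + c * det n (principalMinor r M)
det-perturbDiagonal n r M N c N≗M Nᵣ = begin
  det (suc n) N
    ≡⟨ det-linearRow (suc n) r M (replaceRow r (δ r) M) N c N≗M
         (λ i i≢r j → replaceRow-≢ r (δ r) M j i≢r)
         (λ j → trans (Nᵣ j) (cong (λ x → M r j + c * x) (sym (replaceRow-≡ r (δ r) M j)))) ⟩
  det (suc n) M + c * det (suc n) (replaceRow r (δ r) M)
    ≡⟨ cong (λ x → det (suc n) M + c * x) (det-replaceRow-unit n r M) ⟩
  det (suc n) M + c * det n (principalMinor r M) ∎
  where open ≡-Reasoning

det-subtractNextRow : ∀ n (u : Fin (suc n)) (M : Matrix (suc (suc n))) →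
  det (suc (suc n)) (replaceRow (inject₁ u) (λ j → M (inject₁ u) j - M (suc u) j) M)
    ≡ det (suc (suc n)) M
det-subtractNextRow n u M = sym (begin
  det N M
    ≡⟨ det-linearRow N u₀ A B M (+ 1)
         (λ i i≢u₀ j → sym (replaceRow-≢ u₀ (λ j → M u₀ j - M u₁ j) M j i≢u₀))
         (λ i i≢u₀ j → trans (replaceRow-≢ u₀ (M u₁) M j i≢u₀)
                             (sym (replaceRow-≢ u₀ (λ j → M u₀ j - M u₁ j) M j i≢u₀)))
         (λ j → sym (trans (cong₂ (λ x y → x + + 1 * y) (replaceRow-≡ u₀ (λ j → M u₀ j - M u₁ j) M j)
                                                        (replaceRow-≡ u₀ (M u₁) M j))
                           (cancel (M u₀ j) (M u₁ j)))) ⟩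
  det N A + + 1 * det N B
    ≡⟨ cong (λ x → det N A + + 1 * x) (det-equalAdjacentRows n u B (λ j →
         trans (replaceRow-≡ u₀ (M u₁) M j) (sym (replaceRow-≢ u₀ (M u₁) M j u₁≢u₀)))) ⟩
  det N A + + 1 * + 0
    ≡⟨ ℤ.+-identityʳ (det N A) ⟩
  det N A ∎)
  where
  open ≡-Reasoning
  N = suc (suc n)
  u₀ = inject₁ u
  u₁ = suc u
  A = replaceRow u₀ (λ j → M u₀ j - M u₁ j) M
  B = replaceRow u₀ (M u₁) M
  u₁≢u₀ : u₁ ≢ u₀
  u₁≢u₀ u₁≡u₀ = 1+n≢n (trans (cong toℕ u₁≡u₀) (toℕ-inject₁ u))
  cancel : ∀ x y → x - y + + 1 * y ≡ x
  cancel = solve-∀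

sumFin-δ-difference : ∀ n (k l : Fin n) (γ : ℤ) (g : Fin n → ℤ) →
  sumFin n (λ j → γ * (δ k j - δ l j) * g j) ≡ γ * g k - γ * g l
sumFin-δ-difference n k l γ g = begin
  sumFin n (λ j → γ * (δ k j - δ l j) * g j)
    ≡⟨ sumFin-cong n (λ j → expand γ (δ k j) (δ l j) (g j)) ⟩
  sumFin n (λ j → γ * (δ k j * g j) + - (γ * (δ l j * g j)))
    ≡⟨ sumFin-distrib-+ n (λ j → γ * (δ k j * g j)) (λ j → - (γ * (δ l j * g j))) ⟩
  sumFin n (λ j → γ * (δ k j * g j)) + sumFin n (λ j → - (γ * (δ l j * g j)))
    ≡⟨ cong₂ _+_ (sumFin-*ˡ n γ (λ j → δ k j * g j)) (sumFin-neg n (λ j → γ * (δ l j * g j))) ⟩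
  γ * sumFin n (λ j → δ k j * g j) - sumFin n (λ j → γ * (δ l j * g j))
    ≡⟨ cong₂ (λ x y → γ * x - y) (sumFin-δ n k g) (sumFin-*ˡ n γ (λ j → δ l j * g j)) ⟩
  γ * g k - γ * sumFin n (λ j → δ l j * g j)
    ≡⟨ cong (λ x → γ * g k - γ * x) (sumFin-δ n l g) ⟩
  γ * g k - γ * g l ∎
  where
  open ≡-Reasoning
  expand : ∀ γ x y g → γ * (x - y) * g ≡ γ * (x * g) + - (γ * (y * g))
  expand = solve-∀

det-expandRow-δ-difference : ∀ n (u : Fin (suc n)) (A : Matrix (suc (suc n))) (γ : ℤ) →
  (∀ j → A (inject₁ u) j ≡ γ * (δ (inject₁ u) j - δ (suc u) j)) →
  det (suc (suc n)) A ≡ γ * (det (suc n) (minor (inject₁ u) (inject₁ u) A) + det (suc n) (minor (inject₁ u) (suc u) A))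
det-expandRow-δ-difference n u A γ Aᵤ = begin
  det (suc (suc n)) A
    ≡⟨ det-expandRow (suc n) u₀ A ⟩
  sign (toℕ u₀) * sumFin N (λ j → sign (toℕ j) * A u₀ j * X j)
    ≡⟨ cong (sign (toℕ u₀) *_) (sumFin-cong N (λ j →
         trans (cong (λ x → sign (toℕ j) * x * X j) (Aᵤ j))
               (regroup (sign (toℕ j)) γ (δ u₀ j - δ u₁ j) (X j)))) ⟩
  sign (toℕ u₀) * sumFin N (λ j → γ * (δ u₀ j - δ u₁ j) * (sign (toℕ j) * X j))
    ≡⟨ cong (sign (toℕ u₀) *_) (sumFin-δ-difference N u₀ u₁ γ (λ j → sign (toℕ j) * X j)) ⟩
  sign (toℕ u₀) * (γ * (sign (toℕ u₀) * X u₀) - γ * (sign (suc (toℕ u)) * X u₁))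
    ≡⟨ cong (λ s → sign (toℕ u₀) * (γ * (sign (toℕ u₀) * X u₀) - γ * (s * X u₁)))
         (trans (sign-suc (toℕ u)) (cong (λ k → - sign k) (sym (toℕ-inject₁ u)))) ⟩
  sign (toℕ u₀) * (γ * (sign (toℕ u₀) * X u₀) - γ * (- sign (toℕ u₀) * X u₁))
    ≡⟨ collect (sign (toℕ u₀)) γ (X u₀) (X u₁) ⟩
  γ * (sign (toℕ u₀) * (sign (toℕ u₀) * X u₀) + sign (toℕ u₀) * (sign (toℕ u₀) * X u₁))
    ≡⟨ cong₂ (λ x y → γ * (x + y)) (sign-cancelˡ (toℕ u₀) (X u₀)) (sign-cancelˡ (toℕ u₀) (X u₁)) ⟩
  γ * (X u₀ + X u₁) ∎
  where
  open ≡-Reasoning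
  N = suc (suc n)
  u₀ = inject₁ u
  u₁ = suc u
  X = λ j → det (suc n) (minor u₀ j A)
  regroup : ∀ s γ d X → s * (γ * d) * X ≡ γ * d * (s * X)
  regroup = solve-∀
  collect : ∀ s γ X Y → s * (γ * (s * X) - γ * (- s * Y)) ≡ γ * (s * (s * X) + s * (s * Y))
  collect = solve-∀

punchIn-suc-self : (u : Fin (suc n)) → punchIn (suc u) u ≡ inject₁ u
punchIn-suc-self zero              = refl
punchIn-suc-self {suc n} (suc u) = cong suc (punchIn-suc-self u)

punchIn-inject₁-self : (u : Fin (suc n)) → punchIn (inject₁ u) u ≡ suc u
punchIn-inject₁-self zero              = refl
punchIn-inject₁-self {suc n} (suc u) = cong suc (punchIn-inject₁-self u)

punchIn-suc≡punchIn-inject₁ : (u b : Fin (suc n)) → b ≢ u → punchIn (suc u) b ≡ punchIn (inject₁ u) b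
punchIn-suc≡punchIn-inject₁ zero    zero    b≢u = ⊥-elim (b≢u refl)
punchIn-suc≡punchIn-inject₁ zero    (suc b) b≢u = refl
punchIn-suc≡punchIn-inject₁ {suc n} (suc u) zero    b≢u = refl
punchIn-suc≡punchIn-inject₁ {suc n} (suc u) (suc b) b≢u =
  cong suc (punchIn-suc≡punchIn-inject₁ u b (b≢u ∘ cong suc))

-- Subtracting row suc u from row inject₁ u leaves γ (e_inject₁u − e_suc u) there, so det M is γ times
-- the sum of two minors; one is K = principalMinor (inject₁ u) M and the other differs from K only in
-- its diagonal entry at u, which is smaller by γ.
det-twinRows : ∀ n (M : Matrix (suc (suc n))) (u : Fin (suc n)) (γ : ℤ) →
  (∀ j → M (inject₁ u) j - M (suc u) j ≡ γ * (δ (inject₁ u) j - δ (suc u) j)) →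
  (∀ i → i ≢ inject₁ u → i ≢ suc u → M i (inject₁ u) ≡ M i (suc u)) →
  M (suc u) (inject₁ u) ≡ M (suc u) (suc u) - γ →
  det (suc (suc n)) M ≡
    γ * (+ 2 * det (suc n) (principalMinor (inject₁ u) M)
         - γ * det n (principalMinor u (principalMinor (inject₁ u) M)))
det-twinRows n M u γ rows cols corner = begin
  det (suc (suc n)) M
    ≡⟨ det-subtractNextRow n u M ⟨
  det (suc (suc n)) A
    ≡⟨ det-expandRow-δ-difference n u A γ (λ j → trans (replaceRow-≡ u₀ (λ j → M u₀ j - M u₁ j) M j) (rows j)) ⟩
  γ * (det (suc n) (minor u₀ u₀ A) + det (suc n) (minor u₀ u₁ A))
    ≡⟨ cong₂ (λ x y → γ * (x + y)) (det-cong (suc n) (belowRow u₀)) (det-cong (suc n) (belowRow u₁)) ⟩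
  γ * (det (suc n) K + det (suc n) K′)
    ≡⟨ cong (λ x → γ * (det (suc n) K + x)) (det-perturbDiagonal n u K K′ (- γ) offRow onRow) ⟩
  γ * (det (suc n) K + (det (suc n) K + - γ * det n (principalMinor u K)))
    ≡⟨ collect γ (det (suc n) K) (det n (principalMinor u K)) ⟩
  γ * (+ 2 * det (suc n) K - γ * det n (principalMinor u K)) ∎
  where
  open ≡-Reasoning
  u₀ = inject₁ u
  u₁ = suc u
  A = replaceRow u₀ (λ j → M u₀ j - M u₁ j) M
  K = principalMinor u₀ M
  K′ = minor u₀ u₁ M
  belowRow : ∀ c a b → minor u₀ c A a b ≡ minor u₀ c M a b
  belowRow c a b = replaceRow-≢ u₀ (λ j → M u₀ j - M u₁ j) M (punchIn c b) (punchInᵢ≢i u₀ a)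
  offRow : ∀ a → a ≢ u → ∀ b → K′ a b ≡ K a b
  offRow a a≢u b with b Fin.≟ u
  ... | yes refl = begin
    M (punchIn u₀ a) (punchIn u₁ b) ≡⟨ cong (M (punchIn u₀ a)) (punchIn-suc-self u) ⟩
    M (punchIn u₀ a) u₀             ≡⟨ cols (punchIn u₀ a) (punchInᵢ≢i u₀ a)
                                          (λ eq → a≢u (punchIn-injective u₀ a u
                                                         (trans eq (sym (punchIn-inject₁-self u))))) ⟩
    M (punchIn u₀ a) u₁             ≡⟨ cong (M (punchIn u₀ a)) (punchIn-inject₁-self u) ⟨
    M (punchIn u₀ a) (punchIn u₀ b) ∎
  ... | no b≢u = cong (M (punchIn u₀ a)) (punchIn-suc≡punchIn-inject₁ u b b≢u)
  onRow : ∀ b → K′ u b ≡ K u b + - γ * δ u b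
  onRow b with b Fin.≟ u
  ... | yes refl = begin
    M (punchIn u₀ b) (punchIn u₁ b) ≡⟨ cong₂ M (punchIn-inject₁-self u) (punchIn-suc-self u) ⟩
    M u₁ u₀                         ≡⟨ corner ⟩
    M u₁ u₁ - γ                     ≡⟨ cong (λ i → M i i - γ) (punchIn-inject₁-self u) ⟨
    K u u - γ                       ≡⟨ subtract (K u u) γ ⟩
    K u u + - γ * + 1               ≡⟨ cong (λ x → K u u + - γ * boolToℤ x) (≡ᵇ-refl u) ⟨
    K u u + - γ * δ u u             ∎
    where
    subtract : ∀ x γ → x - γ ≡ x + - γ * + 1
    subtract = solve-∀
  ... | no b≢u = begin
    K′ u b                ≡⟨ cong (M (punchIn u₀ u)) (punchIn-suc≡punchIn-inject₁ u b b≢u) ⟩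
    K u b                 ≡⟨ addZero (K u b) γ ⟩
    K u b + - γ * + 0     ≡⟨ cong (λ x → K u b + - γ * boolToℤ x) (≢⇒≡ᵇ-false (b≢u ∘ sym)) ⟨
    K u b + - γ * δ u b   ∎
    where
    addZero : ∀ x γ → x ≡ x + - γ * + 0
    addZero = solve-∀
  collect : ∀ γ K L → γ * (K + (K + - γ * L)) ≡ γ * (+ 2 * K - γ * L)
  collect = solve-∀

unrollStep : (g κ G F₁ F₀ : ℤ) → ℤ
unrollStep g κ G F₁ F₀ = G * ((+ 1 + κ) * F₁ - κ * g * F₀)

twinRecurrence-solution : ∀ (F : ℕ → ℤ) g → (∀ k → F (suc (suc k)) ≡ g * (+ 2 * F (suc k) - g * F k)) →
  ∀ k → F (suc k) ≡ unrollStep g (+ k) (g ^ k) (F 1) (F 0)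
twinRecurrence-solution F g rec zero          = solution₁ (F 1) g (F 0)
  where
  solution₁ : ∀ F₁ g F₀ → F₁ ≡ + 1 * ((+ 1 + + 0) * F₁ - + 0 * g * F₀)
  solution₁ = solve-∀
twinRecurrence-solution F g rec (suc zero)    = trans (rec 0) (solution₂ (F 1) g (F 0))
  where
  solution₂ : ∀ F₁ g F₀ → g * (+ 2 * F₁ - g * F₀) ≡ g * + 1 * ((+ 1 + + 1) * F₁ - + 1 * g * F₀)
  solution₂ = solve-∀
twinRecurrence-solution F g rec (suc (suc k)) = begin
  F (suc (suc (suc k)))
    ≡⟨ rec (suc k) ⟩
  g * (+ 2 * F (suc (suc k)) - g * F (suc k))
    ≡⟨ cong₂ (λ x y → g * (+ 2 * x - g * y)) (twinRecurrence-solution F g rec (suc k))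
                                             (twinRecurrence-solution F g rec k) ⟩
  g * (+ 2 * unrollStep g (+ suc k) (g * g ^ k) (F 1) (F 0) - g * unrollStep g (+ k) (g ^ k) (F 1) (F 0))
    ≡⟨ induction g (g ^ k) (+ k) (F 1) (F 0) ⟩
  unrollStep g (+ suc (suc k)) (g * (g * g ^ k)) (F 1) (F 0) ∎
  where
  open ≡-Reasoning
  induction : ∀ g G κ F₁ F₀ →
    g * (+ 2 * (g * G * ((+ 1 + (+ 1 + κ)) * F₁ - (+ 1 + κ) * g * F₀)) - g * (G * ((+ 1 + κ) * F₁ - κ * g * F₀)))
      ≡ g * (g * G) * ((+ 1 + (+ 1 + (+ 1 + κ))) * F₁ - (+ 1 + (+ 1 + κ)) * g * F₀)
  induction = solve-∀

-- Symbolic determinants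

-- detᴱ writes out the cofactor expansion as a syntax tree, so that the ring normaliser can evaluate
-- determinants of small matrices with symbolic entries.
sumFinᴱ : ∀ {m} n → (Fin n → Expr ℤ m) → Expr ℤ m
sumFinᴱ zero    f = Κ (+ 0)
sumFinᴱ (suc n) f = f zero ⊕ sumFinᴱ n (f ∘ suc)

detᴱ : ∀ {m} n → (Fin n → Fin n → Expr ℤ m) → Expr ℤ m
detᴱ zero    M = Κ (+ 1)
detᴱ (suc n) M =
  sumFinᴱ (suc n) (λ j → Κ (sign (toℕ j)) ⊗ M zero j ⊗ detᴱ n (λ a b → M (suc a) (punchIn j b)))

⟦sumFinᴱ⟧ : ∀ {m} (ρ : Vec ℤ m) n f → ⟦ sumFinᴱ n f ⟧ ρ ≡ sumFin n (λ i → ⟦ f i ⟧ ρ)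
⟦sumFinᴱ⟧ ρ zero    f = refl
⟦sumFinᴱ⟧ ρ (suc n) f = cong (_+_ (⟦ f zero ⟧ ρ)) (⟦sumFinᴱ⟧ ρ n (f ∘ suc))

⟦detᴱ⟧ : ∀ {m} (ρ : Vec ℤ m) n M → ⟦ detᴱ n M ⟧ ρ ≡ det n (λ i j → ⟦ M i j ⟧ ρ)
⟦detᴱ⟧ ρ zero    M = refl
⟦detᴱ⟧ ρ (suc n) M = trans (⟦sumFinᴱ⟧ ρ (suc n) term) (sumFin-cong (suc n) (λ j →
  cong (sign (toℕ j) * ⟦ M zero j ⟧ ρ *_) (⟦detᴱ⟧ ρ n (rest j))))
  where
  rest = λ j a b → M (suc a) (punchIn j b)
  term = λ j → Κ (sign (toℕ j)) ⊗ M zero j ⊗ detᴱ n (rest j)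

-- Matrices of vertex classes

punchInℕ : ℕ → ℕ → ℕ
punchInℕ zero    k       = suc k
punchInℕ (suc u) zero    = zero
punchInℕ (suc u) (suc k) = suc (punchInℕ u k)

toℕ-punchIn : ∀ {n} (u : Fin (suc n)) (i : Fin n) → toℕ (punchIn u i) ≡ punchInℕ (toℕ u) (toℕ i)
toℕ-punchIn zero    i       = refl
toℕ-punchIn (suc u) zero    = refl
toℕ-punchIn (suc u) (suc i) = cong suc (toℕ-punchIn u i)

≡ᵇ-punchIn : ∀ {n} (u : Fin (suc n)) (i j : Fin n) →
  (toℕ (punchIn u i) ≡ᵇ toℕ (punchIn u j)) ≡ (toℕ i ≡ᵇ toℕ j)
≡ᵇ-punchIn zero    i       j       = refl
≡ᵇ-punchIn (suc u) zero    zero    = refl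
≡ᵇ-punchIn (suc u) zero    (suc j) = refl
≡ᵇ-punchIn (suc u) (suc i) zero    = refl
≡ᵇ-punchIn (suc u) (suc i) (suc j) = ≡ᵇ-punchIn u i j

≡ᵇ-true⇒≡ : ∀ m n → (m ≡ᵇ n) ≡ true → m ≡ n
≡ᵇ-true⇒≡ m n eq = ≡ᵇ⇒≡ m n (Equivalence.from T-≡ eq)

lookupOr : ∀ {A : Set} → A → List A → ℕ → A
lookupOr pad []       k       = pad
lookupOr pad (x ∷ xs) zero    = x
lookupOr pad (x ∷ xs) (suc k) = lookupOr pad xs k

-- Vertex i has class f i; pad is the class read past the end of a list, which no determinant sees.
module ClassMatrix {K : Set} (d : K → ℤ) (a : K → K → ℤ) (pad : K) where

  classMatrix : ∀ n → (ℕ → K) → Matrix n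
  classMatrix n f i j = if toℕ i ≡ᵇ toℕ j then d (f (toℕ i)) else a (f (toℕ i)) (f (toℕ j))

  gap : K → ℤ
  gap C = d C - a C C

  det-classMatrix-cong : ∀ n {f g : ℕ → K} → (∀ k → f k ≡ g k) →
    det n (classMatrix n f) ≡ det n (classMatrix n g)
  det-classMatrix-cong n {f} {g} f≗g = det-cong n entries
    where
    entries : ∀ i j → classMatrix n f i j ≡ classMatrix n g i j
    entries i j rewrite f≗g (toℕ i) | f≗g (toℕ j) = refl

  principalMinor-classMatrix : ∀ n f (u : Fin (suc n)) i j →
    principalMinor u (classMatrix (suc n) f) i j ≡ classMatrix n (f ∘ punchInℕ (toℕ u)) i j
  principalMinor-classMatrix n f u i j
    rewrite ≡ᵇ-punchIn u i j | toℕ-punchIn u i | toℕ-punchIn u j = refl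

  twinRow-difference : ∀ (f : ℕ → K) {C} p k → f p ≡ C → f (suc p) ≡ C →
    (if p ≡ᵇ k then d (f p) else a (f p) (f k)) - (if suc p ≡ᵇ k then d (f (suc p)) else a (f (suc p)) (f k))
      ≡ gap C * (boolToℤ (p ≡ᵇ k) - boolToℤ (suc p ≡ᵇ k))
  twinRow-difference f {C} p k fp fsp with p ≡ᵇ k in p≡ᵇk | suc p ≡ᵇ k in sp≡ᵇk
  ... | true  | true  = ⊥-elim (1+n≢n (trans (≡ᵇ-true⇒≡ (suc p) k sp≡ᵇk) (sym (≡ᵇ-true⇒≡ p k p≡ᵇk))))
  ... | true  | false with refl ← ≡ᵇ-true⇒≡ p k p≡ᵇk rewrite fp | fsp = toGap (d C) (a C C)
    where
    toGap : ∀ x y → x - y ≡ (x - y) * (+ 1 - + 0)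
    toGap = solve-∀
  ... | false | true  with refl ← ≡ᵇ-true⇒≡ (suc p) k sp≡ᵇk rewrite fp | fsp = toGap (d C) (a C C)
    where
    toGap : ∀ x y → y - x ≡ (x - y) * (+ 0 - + 1)
    toGap = solve-∀
  ... | false | false rewrite fp | fsp = toGap (a C (f k)) (gap C)
    where
    toGap : ∀ x g → x - x ≡ g * (+ 0 - + 0)
    toGap = solve-∀

  det-classMatrix-twins : ∀ n (f : ℕ → K) (v : Fin (suc n)) {u C} → toℕ v ≡ u → f u ≡ C → f (suc u) ≡ C →
    det (suc (suc n)) (classMatrix (suc (suc n)) f) ≡
      gap C * (+ 2 * det (suc n) (classMatrix (suc n) (f ∘ punchInℕ u))
               - gap C * det n (classMatrix n (f ∘ punchInℕ u ∘ punchInℕ u)))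
  det-classMatrix-twins n f v {C = C} refl fu fsu = begin
    det (suc (suc n)) M
      ≡⟨ det-twinRows n M v (gap C) rows cols corner ⟩
    gap C * (+ 2 * det (suc n) (principalMinor v₀ M) - gap C * det n (principalMinor v (principalMinor v₀ M)))
      ≡⟨ cong₂ (λ x y → gap C * (+ 2 * x - gap C * y)) (det-cong (suc n) minor₁) (det-cong n minor₂) ⟩
    gap C * (+ 2 * det (suc n) (classMatrix (suc n) g) - gap C * det n (classMatrix n (g ∘ punchInℕ (toℕ v)))) ∎
    where
    open ≡-Reasoning
    M = classMatrix (suc (suc n)) f
    v₀ = inject₁ v
    g = f ∘ punchInℕ (toℕ v)
    rows : ∀ j → M v₀ j - M (suc v) j ≡ gap C * (δ v₀ j - δ (suc v) j)
    rows j rewrite toℕ-inject₁ v = twinRow-difference f (toℕ v) (toℕ j) fu fsu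
    cols : ∀ i → i ≢ v₀ → i ≢ suc v → M i v₀ ≡ M i (suc v)
    cols i i≢v₀ i≢v₁ rewrite ≢⇒≡ᵇ-false i≢v₀ | ≢⇒≡ᵇ-false i≢v₁ | toℕ-inject₁ v | fu | fsu = refl
    corner : M (suc v) v₀ ≡ M (suc v) (suc v) - gap C
    corner rewrite ≢⇒≡ᵇ-false {i = suc v} {v₀} (λ eq → 1+n≢n (trans (cong toℕ eq) (toℕ-inject₁ v)))
                 | ≡ᵇ-refl v | toℕ-inject₁ v | fu | fsu = offDiagonal (d C) (a C C)
      where
      offDiagonal : ∀ x y → y ≡ x - (x - y)
      offDiagonal = solve-∀
    minor₁ : ∀ i j → principalMinor v₀ M i j ≡ classMatrix (suc n) g i j
    minor₁ i j = trans (principalMinor-classMatrix (suc n) f v₀ i j)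
                       (cong (λ w → classMatrix (suc n) (f ∘ punchInℕ w) i j) (toℕ-inject₁ v))
    minor₂ : ∀ i j → principalMinor v (principalMinor v₀ M) i j ≡ classMatrix n (g ∘ punchInℕ (toℕ v)) i j
    minor₂ i j = trans (minor₁ (punchIn v i) (punchIn v j)) (principalMinor-classMatrix n g v i j)

  infixl 9 _!_
  _!_ : List K → ℕ → K
  _!_ = lookupOr pad

  classDet : List K → ℤ
  classDet cs = det (length cs) (classMatrix (length cs) (cs !_))

  !-++-+ : ∀ xs ys i → (xs ++ ys) ! (i ℕ.+ length xs) ≡ ys ! i
  !-++-+ []       ys i = cong (ys !_) (+-identityʳ i)
  !-++-+ (x ∷ xs) ys i = trans (cong ((x ∷ xs ++ ys) !_) (+-suc i (length xs))) (!-++-+ xs ys i)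

  !-punchInℕ : ∀ xs y ys k → (xs ++ y ∷ ys) ! punchInℕ (length xs) k ≡ (xs ++ ys) ! k
  !-punchInℕ []       y ys k       = refl
  !-punchInℕ (x ∷ xs) y ys zero    = refl
  !-punchInℕ (x ∷ xs) y ys (suc k) = !-punchInℕ xs y ys k

  classDet-twins : ∀ xs C ys →
    classDet (xs ++ C ∷ C ∷ ys) ≡ gap C * (+ 2 * classDet (xs ++ C ∷ ys) - gap C * classDet (xs ++ ys))
  classDet-twins xs C ys = begin
    classDet L₂
      ≡⟨ cong (λ N → det N (classMatrix N (L₂ !_))) length₂ ⟩
    det (suc (suc m)) (classMatrix (suc (suc m)) (L₂ !_))
      ≡⟨ det-classMatrix-twins m (L₂ !_) (fromℕ< l<) (toℕ-fromℕ< l<)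
                               (!-++-+ xs (C ∷ C ∷ ys) 0) (!-++-+ xs (C ∷ C ∷ ys) 1) ⟩
    gap C * (+ 2 * det (suc m) (classMatrix (suc m) ((L₂ !_) ∘ punchInℕ l))
             - gap C * det m (classMatrix m ((L₂ !_) ∘ punchInℕ l ∘ punchInℕ l)))
      ≡⟨ cong₂ (λ x y → gap C * (+ 2 * x - gap C * y))
           (det-classMatrix-cong (suc m) (!-punchInℕ xs C (C ∷ ys)))
           (det-classMatrix-cong m (λ k → trans (!-punchInℕ xs C (C ∷ ys) _) (!-punchInℕ xs C ys k))) ⟩
    gap C * (+ 2 * det (suc m) (classMatrix (suc m) (L₁ !_)) - gap C * classDet L₀)
      ≡⟨ cong (λ N → gap C * (+ 2 * det N (classMatrix N (L₁ !_)) - gap C * classDet L₀))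
              (length-++-sucʳ xs C ys) ⟨
    gap C * (+ 2 * classDet L₁ - gap C * classDet L₀) ∎
    where
    open ≡-Reasoning
    L₂ = xs ++ C ∷ C ∷ ys
    L₁ = xs ++ C ∷ ys
    L₀ = xs ++ ys
    l = length xs
    m = length L₀
    length₂ : length L₂ ≡ suc (suc m)
    length₂ = trans (length-++-sucʳ xs C (C ∷ ys)) (cong suc (length-++-sucʳ xs C ys))
    l< : l < suc m
    l< = s≤s (length-++-≤ˡ xs)

  classDet-block : ∀ xs C ys k →
    classDet (xs ++ replicate (suc k) C ++ ys)
      ≡ unrollStep (gap C) (+ k) (gap C ^ k) (classDet (xs ++ C ∷ ys)) (classDet (xs ++ ys))
  classDet-block xs C ys = twinRecurrence-solution (λ k → classDet (xs ++ replicate k C ++ ys)) (gap C)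
    (λ k → classDet-twins xs C (replicate k C ++ ys))

  blocks : List (K × ℕ) → List K
  blocks []             = []
  blocks ((C , k) ∷ bs) = replicate (suc k) C ++ blocks bs

  -- A block (C , κ , G) stands for κ + 1 vertices of class C, with G = gap C ^ κ; κ and G are kept as
  -- integers so that the value of unrolled is a polynomial in them.
  unrolled : List K → List (K × ℤ × ℤ) → ℤ
  unrolled pre []                 = classDet pre
  unrolled pre ((C , κ , G) ∷ bs) = unrollStep (gap C) κ G (unrolled (pre ∷ʳ C) bs) (unrolled pre bs)

  blockData : K × ℕ → K × ℤ × ℤ
  blockData (C , k) = C , + k , gap C ^ k

  classDet-unrolled : ∀ pre bs → classDet (pre ++ blocks bs) ≡ unrolled pre (map blockData bs)
  classDet-unrolled pre []             = cong classDet (++-identityʳ pre)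
  classDet-unrolled pre ((C , k) ∷ bs) = begin
    classDet (pre ++ replicate (suc k) C ++ blocks bs)
      ≡⟨ classDet-block pre C (blocks bs) k ⟩
    unrollStep (gap C) (+ k) (gap C ^ k) (classDet (pre ++ C ∷ blocks bs)) (classDet (pre ++ blocks bs))
      ≡⟨ cong₂ (unrollStep (gap C) (+ k) (gap C ^ k))
           (trans (cong classDet (sym (∷ʳ-++ pre C (blocks bs)))) (classDet-unrolled (pre ∷ʳ C) bs))
           (classDet-unrolled pre bs) ⟩
    unrolled pre (map blockData ((C , k) ∷ bs)) ∎
    where open ≡-Reasoning

  module Symbolic {m} (ρ : Vec ℤ m) (dᴱ : K → Expr ℤ m) (aᴱ : K → K → Expr ℤ m)
    (⟦dᴱ⟧ : ∀ C → ⟦ dᴱ C ⟧ ρ ≡ d C) (⟦aᴱ⟧ : ∀ C D → ⟦ aᴱ C D ⟧ ρ ≡ a C D) where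

    classMatrixᴱ : ∀ n → (ℕ → K) → Fin n → Fin n → Expr ℤ m
    classMatrixᴱ n f i j = if toℕ i ≡ᵇ toℕ j then dᴱ (f (toℕ i)) else aᴱ (f (toℕ i)) (f (toℕ j))

    gapᴱ : K → Expr ℤ m
    gapᴱ C = dᴱ C ⊕ ⊝ aᴱ C C

    unrolledᴱ : List K → List (K × Expr ℤ m × Expr ℤ m) → Expr ℤ m
    unrolledᴱ pre []                 = detᴱ (length pre) (classMatrixᴱ (length pre) (pre !_))
    unrolledᴱ pre ((C , κ , G) ∷ bs) =
      G ⊗ ((Κ (+ 1) ⊕ κ) ⊗ unrolledᴱ (pre ∷ʳ C) bs ⊕ ⊝ (κ ⊗ gapᴱ C ⊗ unrolledᴱ pre bs))

    ⟦_⟧ᵇ : K × Expr ℤ m × Expr ℤ m → K × ℤ × ℤ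
    ⟦ C , κ , G ⟧ᵇ = C , ⟦ κ ⟧ ρ , ⟦ G ⟧ ρ

    ⟦classMatrixᴱ⟧ : ∀ n f i j → ⟦ classMatrixᴱ n f i j ⟧ ρ ≡ classMatrix n f i j
    ⟦classMatrixᴱ⟧ n f i j with toℕ i ≡ᵇ toℕ j
    ... | true  = ⟦dᴱ⟧ (f (toℕ i))
    ... | false = ⟦aᴱ⟧ (f (toℕ i)) (f (toℕ j))

    ⟦unrolledᴱ⟧ : ∀ pre bs → ⟦ unrolledᴱ pre bs ⟧ ρ ≡ unrolled pre (map ⟦_⟧ᵇ bs)
    ⟦unrolledᴱ⟧ pre [] =
      trans (⟦detᴱ⟧ ρ (length pre) (classMatrixᴱ (length pre) (pre !_)))
            (det-cong (length pre) (⟦classMatrixᴱ⟧ (length pre) (pre !_)))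
    ⟦unrolledᴱ⟧ pre ((C , κ , G) ∷ bs) = begin
      ⟦ G ⟧ ρ * ((+ 1 + ⟦ κ ⟧ ρ) * ⟦ unrolledᴱ (pre ∷ʳ C) bs ⟧ ρ
                 - ⟦ κ ⟧ ρ * ⟦ gapᴱ C ⟧ ρ * ⟦ unrolledᴱ pre bs ⟧ ρ)
        ≡⟨ cong₂ (λ g F₀ → ⟦ G ⟧ ρ * ((+ 1 + ⟦ κ ⟧ ρ) * ⟦ unrolledᴱ (pre ∷ʳ C) bs ⟧ ρ
                                     - ⟦ κ ⟧ ρ * g * F₀))
                 ⟦gapᴱ⟧ (⟦unrolledᴱ⟧ pre bs) ⟩
      ⟦ G ⟧ ρ * ((+ 1 + ⟦ κ ⟧ ρ) * ⟦ unrolledᴱ (pre ∷ʳ C) bs ⟧ ρ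
                 - ⟦ κ ⟧ ρ * gap C * unrolled pre (map ⟦_⟧ᵇ bs))
        ≡⟨ cong (λ F₁ → ⟦ G ⟧ ρ * ((+ 1 + ⟦ κ ⟧ ρ) * F₁ - ⟦ κ ⟧ ρ * gap C * unrolled pre (map ⟦_⟧ᵇ bs)))
                (⟦unrolledᴱ⟧ (pre ∷ʳ C) bs) ⟩
      unrolled pre (map ⟦_⟧ᵇ ((C , κ , G) ∷ bs)) ∎
      where
      open ≡-Reasoning
      ⟦gapᴱ⟧ : ⟦ gapᴱ C ⟧ ρ ≡ gap C
      ⟦gapᴱ⟧ = cong₂ _-_ (⟦dᴱ⟧ C) (⟦aᴱ⟧ C C)

-- The graph G_min(s,p)

adj : Part → Part → ℤ
adj C D = boolToℤ (adjPart C D)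

partDegree : ℤ → ℤ → Part → ℤ
partDegree σ π S₁ = σ + σ + π - + 1
partDegree σ π S₂ = σ + σ + π - + 1
partDegree σ π P₁ = σ
partDegree σ π P₂ = σ

-- part s p is thresholdPart s s p.
thresholdPart : ℕ → ℕ → ℕ → ℕ → Part
thresholdPart a b c k =
  if k <ᵇ a then S₁ else (if k <ᵇ a ℕ.+ b then S₂ else (if k <ᵇ a ℕ.+ b ℕ.+ c then P₁ else P₂))

layout : ℕ → ℕ → ℕ → ℕ → List Part
layout a b c d = replicate a S₁ ++ replicate b S₂ ++ replicate c P₁ ++ replicate d P₂ ++ []

lookupOr-replicate : ∀ {A : Set} (x : A) d k → lookupOr x (replicate d x ++ []) k ≡ x
lookupOr-replicate x zero    k       = refl
lookupOr-replicate x (suc d) zero    = refl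
lookupOr-replicate x (suc d) (suc k) = lookupOr-replicate x d k

thresholdPart-layout : ∀ a b c d k → thresholdPart a b c k ≡ lookupOr P₂ (layout a b c d) k
thresholdPart-layout (suc a) b       c       d zero    = refl
thresholdPart-layout (suc a) b       c       d (suc k) = thresholdPart-layout a b c d k
thresholdPart-layout zero    (suc b) c       d zero    = refl
thresholdPart-layout zero    (suc b) c       d (suc k) = thresholdPart-layout zero b c d k
thresholdPart-layout zero    zero    (suc c) d zero    = refl
thresholdPart-layout zero    zero    (suc c) d (suc k) = thresholdPart-layout zero zero c d k
thresholdPart-layout zero    zero    zero    d k       = sym (lookupOr-replicate P₂ d k)

length-layout : ∀ a b c d → length (layout a b c d) ≡ a ℕ.+ b ℕ.+ c ℕ.+ d
length-layout (suc a) b       c       d       = cong suc (length-layout a b c d)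
length-layout zero    (suc b) c       d       = cong suc (length-layout zero b c d)
length-layout zero    zero    (suc c) d       = cong suc (length-layout zero zero c d)
length-layout zero    zero    zero    (suc d) = cong suc (length-layout zero zero zero d)
length-layout zero    zero    zero    zero    = refl

sumFin-thresholdPart : ∀ (F : Part → ℤ) a b c d →
  sumFin (a ℕ.+ b ℕ.+ c ℕ.+ d) (λ j → F (thresholdPart a b c (toℕ j)))
    ≡ + a * F S₁ + + b * F S₂ + + c * F P₁ + + d * F P₂
sumFin-thresholdPart F (suc a) b c d =
  trans (cong (_+_ (F S₁)) (sumFin-thresholdPart F a b c d)) (count (F S₁) (+ a) _ _ _)
  where
  count : ∀ x a b c d → x + (a * x + b + c + d) ≡ (+ 1 + a) * x + b + c + d
  count = solve-∀
sumFin-thresholdPart F zero (suc b) c d =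
  trans (cong (_+_ (F S₂)) (sumFin-thresholdPart F zero b c d)) (count (F S₁) (F S₂) (+ b) (+ c * F P₁) (+ d * F P₂))
  where
  count : ∀ y x b c d → x + (+ 0 * y + b * x + c + d) ≡ + 0 * y + (+ 1 + b) * x + c + d
  count = solve-∀
sumFin-thresholdPart F zero zero (suc c) d =
  trans (cong (_+_ (F P₁)) (sumFin-thresholdPart F zero zero c d)) (count (F S₁) (F S₂) (F P₁) (+ c) (+ d * F P₂))
  where
  count : ∀ y z x c d → x + (+ 0 * y + + 0 * z + c * x + d) ≡ + 0 * y + + 0 * z + (+ 1 + c) * x + d
  count = solve-∀
sumFin-thresholdPart F zero zero zero (suc d) =
  trans (cong (_+_ (F P₂)) (sumFin-thresholdPart F zero zero zero d)) (count (F S₁) (F S₂) (F P₁) (F P₂) (+ d))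
  where
  count : ∀ y z w x d → x + (+ 0 * y + + 0 * z + + 0 * w + d * x) ≡ + 0 * y + + 0 * z + + 0 * w + (+ 1 + d) * x
  count = solve-∀
sumFin-thresholdPart F zero zero zero zero = zeros (F S₁) (F S₂) (F P₁) (F P₂)
  where
  zeros : ∀ y z w x → + 0 ≡ + 0 * y + + 0 * z + + 0 * w + + 0 * x
  zeros = solve-∀

sumFin-≢ : ∀ n (i : Fin n) (g : Fin n → Bool) →
  sumFin n (λ j → boolToℤ (not (toℕ i ≡ᵇ toℕ j) ∧ g j)) + boolToℤ (g i) ≡ sumFin n (λ j → boolToℤ (g j))
sumFin-≢ (suc n) i g = begin
  sumFin (suc n) (λ j → boolToℤ (not (toℕ i ≡ᵇ toℕ j) ∧ g j)) + boolToℤ (g i)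
    ≡⟨ cong (_+ boolToℤ (g i)) (sumFin-punchIn n i (λ j → boolToℤ (not (toℕ i ≡ᵇ toℕ j) ∧ g j))) ⟩
  boolToℤ (not (toℕ i ≡ᵇ toℕ i) ∧ g i)
    + sumFin n (λ k → boolToℤ (not (toℕ i ≡ᵇ toℕ (punchIn i k)) ∧ g (punchIn i k))) + boolToℤ (g i)
    ≡⟨ cong₂ (λ b S → boolToℤ (not b ∧ g i) + S + boolToℤ (g i)) (≡ᵇ-refl i)
         (sumFin-cong n (λ k → cong (λ b → boolToℤ (not b ∧ g (punchIn i k)))
                                    (≢⇒≡ᵇ-false (punchInᵢ≢i i k ∘ sym)))) ⟩
  + 0 + sumFin n (λ k → boolToℤ (g (punchIn i k))) + boolToℤ (g i)
    ≡⟨ reorder (boolToℤ (g i)) (sumFin n (λ k → boolToℤ (g (punchIn i k)))) ⟩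
  boolToℤ (g i) + sumFin n (λ k → boolToℤ (g (punchIn i k)))
    ≡⟨ sumFin-punchIn n i (λ j → boolToℤ (g j)) ⟨
  sumFin (suc n) (λ j → boolToℤ (g j)) ∎
  where
  open ≡-Reasoning
  reorder : ∀ x S → + 0 + S + x ≡ x + S
  reorder = solve-∀

countedDegree : ∀ C σ π →
  σ * adj C S₁ + σ * adj C S₂ + π * adj C P₁ + π * adj C P₂ - adj C C ≡ partDegree σ π C
countedDegree S₁ = count
  where
  count : ∀ σ π → σ * + 1 + σ * + 1 + π * + 1 + π * + 0 - + 1 ≡ σ + σ + π - + 1
  count = solve-∀
countedDegree S₂ = count
  where
  count : ∀ σ π → σ * + 1 + σ * + 1 + π * + 0 + π * + 1 - + 1 ≡ σ + σ + π - + 1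
  count = solve-∀
countedDegree P₁ = count
  where
  count : ∀ σ π → σ * + 1 + σ * + 0 + π * + 0 + π * + 0 - + 0 ≡ σ
  count = solve-∀
countedDegree P₂ = count
  where
  count : ∀ σ π → σ * + 0 + σ * + 1 + π * + 0 + π * + 0 - + 0 ≡ σ
  count = solve-∀

degree-Gmin : ∀ s p i → degree (Gmin s p) i ≡ partDegree (+ s) (+ p) (part s p (toℕ i))
degree-Gmin s p i = begin
  degree (Gmin s p) i
    ≡⟨ x≡x+y-y (degree (Gmin s p) i) (adj C C) ⟩
  degree (Gmin s p) i + adj C C - adj C C
    ≡⟨ cong (_- adj C C) (sumFin-≢ N i (λ j → adjPart C (part s p (toℕ j)))) ⟩
  sumFin N (λ j → adj C (thresholdPart s s p (toℕ j))) - adj C C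
    ≡⟨ cong (_- adj C C) (sumFin-thresholdPart (adj C) s s p p) ⟩
  + s * adj C S₁ + + s * adj C S₂ + + p * adj C P₁ + + p * adj C P₂ - adj C C
    ≡⟨ countedDegree C (+ s) (+ p) ⟩
  partDegree (+ s) (+ p) C ∎
  where
  open ≡-Reasoning
  N = s ℕ.+ s ℕ.+ p ℕ.+ p
  C = part s p (toℕ i)
  x≡x+y-y : ∀ x y → x ≡ x + y - y
  x≡x+y-y = solve-∀

module Gmin-classes (t σ π : ℤ) = ClassMatrix (λ C → t - partDegree σ π C) adj P₂

charPoly-Gmin : ∀ s p t → charPolyAt (laplacian (Gmin s p)) t ≡ Gmin-classes.classDet t (+ s) (+ p) (layout s s p p)
charPoly-Gmin s p t = begin
  det N (λ i j → (if toℕ i ≡ᵇ toℕ j then t else + 0) - laplacian (Gmin s p) i j)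
    ≡⟨ det-cong N entries ⟩
  det N (classMatrix N (L !_))
    ≡⟨ cong (λ n → det n (classMatrix n (L !_))) (length-layout s s p p) ⟨
  classDet L ∎
  where
  open ≡-Reasoning
  open Gmin-classes t (+ s) (+ p)
  N = s ℕ.+ s ℕ.+ p ℕ.+ p
  L = layout s s p p
  entries : ∀ i j → (if toℕ i ≡ᵇ toℕ j then t else + 0) - laplacian (Gmin s p) i j ≡ classMatrix N (L !_) i j
  entries i j with toℕ i ≡ᵇ toℕ j
  ... | true  = cong (_-_ t) (trans (degree-Gmin s p i)
                                    (cong (partDegree (+ s) (+ p)) (thresholdPart-layout s s p p (toℕ i))))
  ... | false = trans (zero-minus-neg (adj (part s p (toℕ i)) (part s p (toℕ j))))
                      (cong₂ adj (thresholdPart-layout s s p p (toℕ i)) (thresholdPart-layout s s p p (toℕ j)))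
    where
    zero-minus-neg : ∀ x → + 0 - - x ≡ x
    zero-minus-neg = solve-∀

gap-S₁ : ∀ t σ π → Gmin-classes.gap t σ π S₁ ≡ t - (σ + σ + π)
gap-S₁ = simplify
  where
  simplify : ∀ t σ π → t - (σ + σ + π - + 1) - + 1 ≡ t - (σ + σ + π)
  simplify = solve-∀

gap-P₁ : ∀ t σ π → Gmin-classes.gap t σ π P₁ ≡ t - σ
gap-P₁ t σ π = ℤ.+-identityʳ (t - σ)

Gmin-blockData : (σ π GS GP : ℤ) → List (Part × ℤ × ℤ)
Gmin-blockData σ π GS GP =
  (S₁ , σ - + 1 , GS) ∷ (S₂ , σ - + 1 , GS) ∷ (P₁ , π - + 1 , GP) ∷ (P₂ , π - + 1 , GP) ∷ []

unrolled-Gmin : ∀ t σ π GS GP →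
  Gmin-classes.unrolled t σ π [] (Gmin-blockData σ π GS GP)
    ≡ t * (GS * GS) * (t - (σ + π)) * (GP * GP) * (t * t - (+ 3 * σ + π) * t + + 2 * σ * σ)
unrolled-Gmin t σ π GS GP = begin
  unrolled [] (Gmin-blockData σ π GS GP)
    ≡⟨ cong (unrolled []) blocks≡ ⟩
  unrolled [] (map ⟦_⟧ᵇ blocksᴱ)
    ≡⟨ ⟦unrolledᴱ⟧ [] blocksᴱ ⟨
  ⟦ unrolledᴱ [] blocksᴱ ⟧ ρ
    ≡⟨ prove ρ (unrolledᴱ [] blocksᴱ) rhsᴱ refl ⟩
  ⟦ rhsᴱ ⟧ ρ ∎
  where
  open ≡-Reasoning
  ρ = t ∷ σ ∷ π ∷ GS ∷ GP ∷ []
  tᴱ σᴱ πᴱ GSᴱ GPᴱ : Expr ℤ 5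
  tᴱ  = Ι zero
  σᴱ  = Ι (suc zero)
  πᴱ  = Ι (suc (suc zero))
  GSᴱ = Ι (suc (suc (suc zero)))
  GPᴱ = Ι (suc (suc (suc (suc zero))))
  partDegreeᴱ : Part → Expr ℤ 5
  partDegreeᴱ S₁ = σᴱ ⊕ σᴱ ⊕ πᴱ ⊕ ⊝ Κ (+ 1)
  partDegreeᴱ S₂ = σᴱ ⊕ σᴱ ⊕ πᴱ ⊕ ⊝ Κ (+ 1)
  partDegreeᴱ P₁ = σᴱ
  partDegreeᴱ P₂ = σᴱ
  diagonalᴱ : Part → Expr ℤ 5
  diagonalᴱ C = tᴱ ⊕ ⊝ partDegreeᴱ C
  ⟦diagonalᴱ⟧ : ∀ C → ⟦ diagonalᴱ C ⟧ ρ ≡ t - partDegree σ π C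
  ⟦diagonalᴱ⟧ S₁ = refl
  ⟦diagonalᴱ⟧ S₂ = refl
  ⟦diagonalᴱ⟧ P₁ = refl
  ⟦diagonalᴱ⟧ P₂ = refl
  open Gmin-classes t σ π
  open Symbolic ρ diagonalᴱ (λ C D → Κ (adj C D)) ⟦diagonalᴱ⟧ (λ C D → refl)
  blocksᴱ : List (Part × Expr ℤ 5 × Expr ℤ 5)
  blocksᴱ = (S₁ , σᴱ ⊕ ⊝ Κ (+ 1) , GSᴱ) ∷ (S₂ , σᴱ ⊕ ⊝ Κ (+ 1) , GSᴱ)
          ∷ (P₁ , πᴱ ⊕ ⊝ Κ (+ 1) , GPᴱ) ∷ (P₂ , πᴱ ⊕ ⊝ Κ (+ 1) , GPᴱ) ∷ []
  blocks≡ : Gmin-blockData σ π GS GP ≡ map ⟦_⟧ᵇ blocksᴱ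
  blocks≡ = refl
  rhsᴱ : Expr ℤ 5
  rhsᴱ = tᴱ ⊗ (GSᴱ ⊗ GSᴱ) ⊗ (tᴱ ⊕ ⊝ (σᴱ ⊕ πᴱ)) ⊗ (GPᴱ ⊗ GPᴱ)
         ⊗ (tᴱ ⊗ tᴱ ⊕ ⊝ ((Κ (+ 3) ⊗ σᴱ ⊕ πᴱ) ⊗ tᴱ) ⊕ Κ (+ 2) ⊗ σᴱ ⊗ σᴱ)

Gmin-blocks : ℕ → ℕ → List (Part × ℕ)
Gmin-blocks s′ p′ = (S₁ , s′) ∷ (S₂ , s′) ∷ (P₁ , p′) ∷ (P₂ , p′) ∷ []

-- The refl steps only rewrite arguments: checking two different-looking instances of these
-- determinants for conversion directly would make Agda unfold them.
charPoly-Gmin-unrolled : ∀ s′ p′ t → let open Gmin-classes t (+ suc s′) (+ suc p′) in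
  charPolyAt (laplacian (Gmin (suc s′) (suc p′))) t
    ≡ t * (gap S₁ ^ s′ * gap S₁ ^ s′) * (t - (+ suc s′ + + suc p′)) * (gap P₁ ^ p′ * gap P₁ ^ p′)
        * (t * t - (+ 3 * + suc s′ + + suc p′) * t + + 2 * + suc s′ * + suc s′)
charPoly-Gmin-unrolled s′ p′ t = begin
  charPolyAt (laplacian (Gmin (suc s′) (suc p′))) t
    ≡⟨ charPoly-Gmin (suc s′) (suc p′) t ⟩
  classDet (layout (suc s′) (suc s′) (suc p′) (suc p′))
    ≡⟨ cong classDet layout≡blocks ⟩
  classDet ([] ++ blocks (Gmin-blocks s′ p′))
    ≡⟨ classDet-unrolled [] (Gmin-blocks s′ p′) ⟩
  unrolled [] (map blockData (Gmin-blocks s′ p′))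
    ≡⟨ cong (unrolled []) blockData≡ ⟩
  unrolled [] (Gmin-blockData (+ suc s′) (+ suc p′) (gap S₁ ^ s′) (gap P₁ ^ p′))
    ≡⟨ unrolled-Gmin t (+ suc s′) (+ suc p′) (gap S₁ ^ s′) (gap P₁ ^ p′) ⟩
  t * (gap S₁ ^ s′ * gap S₁ ^ s′) * (t - (+ suc s′ + + suc p′)) * (gap P₁ ^ p′ * gap P₁ ^ p′)
    * (t * t - (+ 3 * + suc s′ + + suc p′) * t + + 2 * + suc s′ * + suc s′) ∎
  where
  open ≡-Reasoning
  open Gmin-classes t (+ suc s′) (+ suc p′)
  layout≡blocks : layout (suc s′) (suc s′) (suc p′) (suc p′) ≡ [] ++ blocks (Gmin-blocks s′ p′)
  layout≡blocks = refl
  blockData≡ : map blockData (Gmin-blocks s′ p′)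
             ≡ Gmin-blockData (+ suc s′) (+ suc p′) (gap S₁ ^ s′) (gap P₁ ^ p′)
  blockData≡ = refl

^-double : ∀ g k → g ^ (2 ℕ.* k) ≡ g ^ k * g ^ k
^-double g k = trans (ℤ.^-distribˡ-+-* g k (k ℕ.+ 0)) (cong (λ m → g ^ k * g ^ m) (+-identityʳ k))

-- The proof needs only s, p ≥ 1.
corollary3 : (s p : ℕ) → 2 ≤ s → 2 ≤ p → (t : ℤ) →
    charPolyAt (laplacian (Gmin s p)) t
    ≡ t
    * (t - + (s Data.Nat.+ s Data.Nat.+ p)) ^ (2 Data.Nat.* (s ∸ 1))
    * (t - + (s Data.Nat.+ p))
    * (t - + s) ^ (2 Data.Nat.* (p ∸ 1))
    * (t * t - + (3 Data.Nat.* s Data.Nat.+ p) * t + + (2 Data.Nat.* s Data.Nat.* s))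
corollary3 s@(suc s′) p@(suc p′) (s≤s _) (s≤s _) t = begin
  charPolyAt (laplacian (Gmin s p)) t
    ≡⟨ charPoly-Gmin-unrolled s′ p′ t ⟩
  t * (gap S₁ ^ s′ * gap S₁ ^ s′) * (t - (+ s + + p)) * (gap P₁ ^ p′ * gap P₁ ^ p′)
    * (t * t - (+ 3 * + s + + p) * t + + 2 * + s * + s)
    ≡⟨ cong₂ (λ A B → t * A * (t - (+ s + + p)) * B * (t * t - (+ 3 * + s + + p) * t + + 2 * + s * + s))
             (squares s′ (gap-S₁ t (+ s) (+ p))) (squares p′ (gap-P₁ t (+ s) (+ p))) ⟩
  t * (t - + (s ℕ.+ s ℕ.+ p)) ^ (2 ℕ.* (s ∸ 1)) * (t - (+ s + + p)) * (t - + s) ^ (2 ℕ.* (p ∸ 1))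
    * (t * t - (+ 3 * + s + + p) * t + + 2 * + s * + s)
    ≡⟨ cong₂ (λ a q → t * (t - + (s ℕ.+ s ℕ.+ p)) ^ (2 ℕ.* (s ∸ 1)) * (t - a) * (t - + s) ^ (2 ℕ.* (p ∸ 1)) * q)
             +-pos quadratic-pos ⟩
  t * (t - + (s ℕ.+ s ℕ.+ p)) ^ (2 ℕ.* (s ∸ 1)) * (t - + (s ℕ.+ p)) * (t - + s) ^ (2 ℕ.* (p ∸ 1))
    * (t * t - + (3 ℕ.* s ℕ.+ p) * t + + (2 ℕ.* s ℕ.* s)) ∎
  where
  open ≡-Reasoning
  open Gmin-classes t (+ s) (+ p)
  squares : ∀ {g h : ℤ} k → g ≡ h → g ^ k * g ^ k ≡ h ^ (2 ℕ.* (suc k ∸ 1))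
  squares {g} k refl = sym (^-double g k)
  +-pos : + s + + p ≡ + (s ℕ.+ p)
  +-pos = refl
  quadratic-pos : t * t - (+ 3 * + s + + p) * t + + 2 * + s * + s
                ≡ t * t - + (3 ℕ.* s ℕ.+ p) * t + + (2 ℕ.* s ℕ.* s)
  quadratic-pos = refl
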